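{- Let $G$ be a graph with minimum degree at least three and let $F$ be a forest that is a subgraph of $G$. If $G/E(F)$ is simple and $3$-connected, then $G$ is $3$-connected.
   Context: $G$ is a finite simple graph. Here $G/E(F)$ denotes the graph obtained by contracting the edges of $F$ without simplifying (parallel edges and loops that arise are kept). A graph is $3$-connected if it has more than $3$ vertices and no vertex cut of size less than $3$. -}

module Defs where

open import Data.Nat using (ℕ; zero; suc; _+_; _≤_; _<_)
open import Data.Bool using (Bool; true; false; if_then_else_)
open import Data.Fin using (Fin; zero; suc; inject₁; fromℕ)
open import Data.Fin.Subset using (Subset; _∈_; _∉_; ∣_∣) renaming (⊥ to ∅)
open import Data.List using (List; map; allFin)
open import Data.Nat.ListAction using (sum)
open import Data.Product using (Σ; ∃; _×_; _,_)
open import Data.Sum using (_⊎_)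
open import Function.Bundles using (_⇔_)
open import Relation.Nullary using (¬_)
open import Relation.Binary.PropositionalEquality using (_≡_; _≢_)

record Graph (n : ℕ) : Set where
  field
    adj    : Fin n → Fin n → Bool
    sym    : ∀ u v → adj u v ≡ adj v u
    irrefl : ∀ u → adj u u ≡ false
open Graph public

Edge : ∀ {n} → Graph n → Fin n → Fin n → Set
Edge G u v = adj G u v ≡ true

deg : ∀ {n} → Graph n → Fin n → ℕ
deg {n} G u = sum (map (λ v → if adj G u v then 1 else 0) (allFin n))

minDegree≥ : ∀ {n} → ℕ → Graph n → Set
minDegree≥ k G = ∀ u → k ≤ deg G u

-- H is a subgraph of G (on the same vertex set; isolated vertices are
-- irrelevant for contraction)
_⊆G_ : ∀ {n} → Graph n → Graph n → Set
F ⊆G G = ∀ u v → Edge F u v → Edge G u v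

record Cycle {n : ℕ} (G : Graph n) : Set where
  field
    k      : ℕ
    c      : Fin (suc (suc (suc k))) → Fin n
    inj    : ∀ i j → c i ≡ c j → i ≡ j
    step   : ∀ (i : Fin (suc (suc k))) → Edge G (c (inject₁ i)) (c (suc i))
    close  : Edge G (c (fromℕ (suc (suc k)))) (c zero)

Forest : ∀ {n} → Graph n → Set
Forest G = ¬ Cycle G

-- Reachability in a graph given by an adjacency relation, through
-- vertices not in S (the start vertex is assumed outside S separately).
data Reach {n : ℕ} (Adj : Fin n → Fin n → Set) (S : Subset n)
     : Fin n → Fin n → Set where
  here : ∀ {u} → Reach Adj S u u
  step : ∀ {u w v} → Adj u w → w ∉ S → Reach Adj S w v → Reach Adj S u v

KConnected : ℕ → (n : ℕ) → (Fin n → Fin n → Set) → Set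
KConnected k n Adj =
  k < n × (∀ (S : Subset n) → ∣ S ∣ < k → ∀ u v → u ∉ S → v ∉ S → Reach Adj S u v)

ThreeConnected : ∀ {n} → Graph n → Set
ThreeConnected {n} G = KConnected 3 n (Edge G)

-- Contraction G/E(F).  Its vertices are the components of the spanning
-- subgraph (V(G), E(F)), represented by a surjection π : Fin n → Fin m
-- whose fibres are exactly these components.
IsContractionMap : ∀ {n} (F : Graph n) (m : ℕ) → (Fin n → Fin m) → Set
IsContractionMap {n} F m π =
  (∀ u v → (π u ≡ π v) ⇔ Reach (Edge F) ∅ u v) × (∀ a → ∃ λ u → π u ≡ a)

-- The edges of G/E(F) are the edges of G not in F (edges of F are contracted).
-- An edge uv of G∖E(F) yields an edge (loop if π u ≡ π v) between π u and π v.
ContrEdge : ∀ {n m} (G F : Graph n) → (Fin n → Fin m) → Fin m → Fin m → Set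
ContrEdge G F π a b =
  Σ _ λ u → Σ _ λ v → Edge G u v × adj F u v ≡ false × π u ≡ a × π v ≡ b

-- G/E(F) (without simplification) is simple: no loops and no parallel edges.
ContrSimple : ∀ {n m} (G F : Graph n) → (Fin n → Fin m) → Set
ContrSimple G F π =
  (∀ u v → Edge G u v → adj F u v ≡ false → π u ≢ π v)
  × (∀ u v u' v' → Edge G u v → adj F u v ≡ false
                 → Edge G u' v' → adj F u' v' ≡ false
                 → π u ≡ π u' → π v ≡ π v'
                 → (u ≡ u' × v ≡ v') ⊎ (u ≡ v' × v ≡ u'))

{-# OPTIONS --safe #-}
module Submission where

-- Fix S with |S| < 3 and cover it by two vertices s₁, s₂.  Every vertex x ∉ S reaches, in G − S,
-- a vertex outside the fibres of s₁ and s₂.  Indeed, if x lies in the fibre of s = sᵢ, which is a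
-- tree of F, walk from x along F without backtracking.  A non-F edge from the current vertex y
-- into a third fibre lets us escape; otherwise every non-F edge at y goes to the fibre of the
-- other sⱼ, and since G/E(F) is simple there is at most one of them.  As deg y ≥ 3, y then has an
-- F-neighbour other than that edge's end and the previous vertex.  F being a forest, the walk
-- never repeats a vertex, so it escapes or hits s; in the latter case walk again starting from s:
-- this second walk cannot return to s, so it must escape.  Two escaped vertices are joined in
-- G/E(F) minus the fibres of s₁ and s₂, and such a path lifts to G − S because fibres are
-- F-connected.

open import Defs hiding (sym; irrefl)
open import Data.Nat using (ℕ; zero; suc; _+_; _≤_; _<_; z≤n; s≤s)
open import Data.Nat.Properties
  using ( ≤-refl; ≤-trans; ≤-reflexive; <-≤-trans; +-monoʳ-≤; n≤1+n; +-suc; +-identityʳ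
        ; m≤n+m; m≤m+n; <⇒≱; 1+n≰n; module ≤-Reasoning )
open import Data.Nat.ListAction using (sum)
open import Data.Bool using (Bool; true; false; if_then_else_)
open import Data.Bool.Properties using (¬-not) renaming (_≟_ to _≟ᵇ_)
open import Data.Fin using (Fin; zero; suc; toℕ)
open import Data.Fin.Properties
  using (_≟_; any?; toℕ-injective; toℕ-inject₁; toℕ-fromℕ; toℕ<n; toℕ≤pred[n]; injective⇒≤)
open import Data.Fin.Subset using (Subset; _∈_; _∉_; _⊆_; ∣_∣; ⁅_⁆; _∪_; _-_) renaming (⊥ to ∅)
open import Data.Fin.Subset.Properties
  using ( ∉⊥; nonempty?; x∈p∧x≢y⇒x∈p-y; x∈p⇒∣p-x∣<∣p∣; p⊆q⇒∣p∣≤∣q∣; ∣⁅x⁆∣≡1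
        ; x∈p∪q⁺; x∈p∪q⁻; x∈⁅x⁆; x∈⁅y⁆⇒x≡y )
open import Data.Vec using ([]; _∷_) renaming (tabulate to tabulateᵛ)
open import Data.Vec.Properties using (lookup∘tabulate; []=⇒lookup)
open import Data.List using (tabulate)
open import Data.List.Properties using (map-tabulate)
open import Data.Product using (∃; ∃₂; _×_; _,_; proj₁; proj₂)
import Data.Product as Product
open import Data.Sum using (_⊎_; inj₁; inj₂; [_,_]′)
import Data.Sum as Sum
open import Data.Empty using (⊥-elim)
open import Function using (_∘_; id)
open import Function.Bundles using (Equivalence)
open import Relation.Nullary using (¬_; Dec; yes; no; contradiction)
open import Relation.Nullary.Decidable using (_×-dec_; ¬?)
open import Relation.Binary.PropositionalEquality
  using (_≡_; _≢_; refl; sym; trans; cong; cong₂; subst)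

module _ {n : ℕ} {Adj : Fin n → Fin n → Set} {S : Subset n} where

  reach-trans : ∀ {a b c} → Reach Adj S a b → Reach Adj S b c → Reach Adj S a c
  reach-trans here         R′ = R′
  reach-trans (step e w R) R′ = step e w (reach-trans R R′)

  reach-reverse : (∀ {x y} → Adj x y → Adj y x) →
                  ∀ {a b} → a ∉ S → Reach Adj S a b → Reach Adj S b a
  reach-reverse adj-sym a∉S here           = here
  reach-reverse adj-sym a∉S (step e w∉S R) =
    reach-trans (reach-reverse adj-sym w∉S R) (step (adj-sym e) a∉S here)

edge-sym : ∀ {n} (G : Graph n) {x y} → Edge G x y → Edge G y x
edge-sym G {x} {y} e = trans (Graph.sym G y x) e

edge-irrefl : ∀ {n} (G : Graph n) {x} → ¬ Edge G x x
edge-irrefl G {x} e with trans (sym e) (Graph.irrefl G x)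
... | ()

∣p∪q∣≤∣p∣+∣q∣ : ∀ {n} (p q : Subset n) → ∣ p ∪ q ∣ ≤ ∣ p ∣ + ∣ q ∣
∣p∪q∣≤∣p∣+∣q∣ []          []          = z≤n
∣p∪q∣≤∣p∣+∣q∣ (true ∷ p)  (true ∷ q)  =
  s≤s (≤-trans (∣p∪q∣≤∣p∣+∣q∣ p q) (+-monoʳ-≤ ∣ p ∣ (n≤1+n ∣ q ∣)))
∣p∪q∣≤∣p∣+∣q∣ (true ∷ p)  (false ∷ q) = s≤s (∣p∪q∣≤∣p∣+∣q∣ p q)
∣p∪q∣≤∣p∣+∣q∣ (false ∷ p) (true ∷ q)  =
  ≤-trans (s≤s (∣p∪q∣≤∣p∣+∣q∣ p q)) (≤-reflexive (sym (+-suc ∣ p ∣ ∣ q ∣)))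
∣p∪q∣≤∣p∣+∣q∣ (false ∷ p) (false ∷ q) = ∣p∪q∣≤∣p∣+∣q∣ p q

∣⁅x⁆∪⁅y⁆∣≤2 : ∀ {n} (x y : Fin n) → ∣ ⁅ x ⁆ ∪ ⁅ y ⁆ ∣ ≤ 2
∣⁅x⁆∪⁅y⁆∣≤2 x y =
  ≤-trans (∣p∪q∣≤∣p∣+∣q∣ ⁅ x ⁆ ⁅ y ⁆) (≤-reflexive (cong₂ _+_ (∣⁅x⁆∣≡1 x) (∣⁅x⁆∣≡1 y)))

covered-by-two : ∀ {n} (S : Subset n) → ∣ S ∣ < 3 → Fin n →
                 ∃₂ λ s₁ s₂ → ∀ {x} → x ∈ S → x ≡ s₁ ⊎ x ≡ s₂
covered-by-two S ∣S∣<3 d with nonempty? S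
... | no S-empty = d , d , λ {x} x∈S → ⊥-elim (S-empty (x , x∈S))
... | yes (a , a∈S) with nonempty? (S - a)
...   | no S-a-empty = a , a , inj₁ ∘ is-a
  where
  is-a : ∀ {x} → x ∈ S → x ≡ a
  is-a {x} x∈S with x ≟ a
  ... | yes x≡a = x≡a
  ... | no  x≢a = ⊥-elim (S-a-empty (x , x∈p∧x≢y⇒x∈p-y x∈S x≢a))
...   | yes (b , b∈S-a) = a , b , is-a-or-b
  where
  is-a-or-b : ∀ {x} → x ∈ S → x ≡ a ⊎ x ≡ b
  is-a-or-b {x} x∈S with x ≟ a | x ≟ b
  ... | yes x≡a | _       = inj₁ x≡a
  ... | no  _   | yes x≡b = inj₂ x≡b
  ... | no  x≢a | no  x≢b = contradiction three-elements (<⇒≱ ∣S∣<3)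
    where
    open ≤-Reasoning
    x∈S-a-b : x ∈ S - a - b
    x∈S-a-b = x∈p∧x≢y⇒x∈p-y (x∈p∧x≢y⇒x∈p-y x∈S x≢a) x≢b
    three-elements : 3 ≤ ∣ S ∣
    three-elements = begin
      3                     ≤⟨ m≤m+n 3 _ ⟩
      3 + ∣ S - a - b - x ∣  ≤⟨ s≤s (s≤s (x∈p⇒∣p-x∣<∣p∣ x∈S-a-b)) ⟩
      2 + ∣ S - a - b ∣      ≤⟨ s≤s (x∈p⇒∣p-x∣<∣p∣ b∈S-a) ⟩
      1 + ∣ S - a ∣          ≤⟨ x∈p⇒∣p-x∣<∣p∣ a∈S ⟩
      ∣ S ∣                 ∎

neighbours : ∀ {n} → Graph n → Fin n → Subset n
neighbours G y = tabulateᵛ (adj G y)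

∈neighbours⇒edge : ∀ {n} (G : Graph n) {y z} → z ∈ neighbours G y → Edge G y z
∈neighbours⇒edge G {y} {z} z∈N = trans (sym (lookup∘tabulate (adj G y) z)) ([]=⇒lookup z∈N)

sum-indicator≡∣tabulate∣ : ∀ {n} (b : Fin n → Bool) →
                           sum (tabulate (λ v → if b v then 1 else 0)) ≡ ∣ tabulateᵛ b ∣
sum-indicator≡∣tabulate∣ {zero}  b = refl
sum-indicator≡∣tabulate∣ {suc n} b with b zero
... | true  = cong suc (sum-indicator≡∣tabulate∣ (b ∘ suc))
... | false = sum-indicator≡∣tabulate∣ (b ∘ suc)

deg≡∣neighbours∣ : ∀ {n} (G : Graph n) y → deg G y ≡ ∣ neighbours G y ∣
deg≡∣neighbours∣ G y = trans (cong sum (map-tabulate id (λ v → if adj G y v then 1 else 0)))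
                             (sum-indicator≡∣tabulate∣ (adj G y))

deg≥3⇒neighbour-avoiding : ∀ {n} (G : Graph n) {y} → 3 ≤ deg G y →
                           ∀ p q → ∃ λ z → Edge G y z × z ≢ p × z ≢ q
deg≥3⇒neighbour-avoiding G {y} 3≤deg p q
  with any? (λ z → (adj G y z ≟ᵇ true) ×-dec (¬? (z ≟ p) ×-dec ¬? (z ≟ q)))
... | yes found = found
... | no  none  = contradiction 3≤2 1+n≰n
  where
  open ≤-Reasoning
  N⊆pq : neighbours G y ⊆ ⁅ p ⁆ ∪ ⁅ q ⁆
  N⊆pq {z} z∈N with z ≟ p | z ≟ q
  ... | yes refl | _        = x∈p∪q⁺ (inj₁ (x∈⁅x⁆ z))
  ... | no  _    | yes refl = x∈p∪q⁺ (inj₂ (x∈⁅x⁆ z))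
  ... | no  z≢p  | no  z≢q  = ⊥-elim (none (z , ∈neighbours⇒edge G z∈N , z≢p , z≢q))
  3≤2 : 3 ≤ 2
  3≤2 = begin
    3                  ≤⟨ 3≤deg ⟩
    deg G y            ≡⟨ deg≡∣neighbours∣ G y ⟩
    ∣ neighbours G y ∣  ≤⟨ p⊆q⇒∣p∣≤∣q∣ N⊆pq ⟩
    ∣ ⁅ p ⁆ ∪ ⁅ q ⁆ ∣    ≤⟨ ∣⁅x⁆∪⁅y⁆∣≤2 p q ⟩
    2                  ∎

module _ {n : ℕ} {F : Graph n} where

  cycle-from-path : (w : ℕ → Fin n) (k : ℕ)
    → (∀ i → i < 2 + k → Edge F (w i) (w (suc i)))
    → (∀ i j → i ≤ 2 + k → j ≤ 2 + k → w i ≡ w j → i ≡ j)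
    → Edge F (w (2 + k)) (w 0)
    → Cycle F
  cycle-from-path w k edges inj closing = record
    { k     = k
    ; c     = w ∘ toℕ
    ; inj   = λ i j eq →
                toℕ-injective (inj (toℕ i) (toℕ j) (toℕ≤pred[n] i) (toℕ≤pred[n] j) eq)
    ; step  = λ i → subst (λ t → Edge F (w t) (w (suc (toℕ i)))) (sym (toℕ-inject₁ i))
                          (edges (toℕ i) (toℕ<n i))
    ; close = subst (λ t → Edge F (w t) (w 0)) (sym (toℕ-fromℕ (2 + k))) closing
    }

  -- A path of F listed backwards: vtx 0 is its current end and vtx len its first vertex.
  -- The values of vtx beyond len are irrelevant.
  record Path (start : Fin n) : Set where
    field
      len   : ℕ
      vtx   : ℕ → Fin n
      ends  : vtx len ≡ start
      edges : ∀ i → i < len → Edge F (vtx i) (vtx (suc i))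
      inj   : ∀ i j → i ≤ len → j ≤ len → vtx i ≡ vtx j → i ≡ j

  trivial-path : ∀ start → Path start
  trivial-path start = record
    { len = 0 ; vtx = λ _ → start ; ends = refl
    ; edges = λ _ () ; inj = λ { _ _ z≤n z≤n _ → refl } }

  path-len<n : ∀ {start} (p : Path start) → Path.len p < n
  path-len<n p = injective⇒≤ {f = vtx ∘ toℕ}
    (λ eq → toℕ-injective (inj _ _ (toℕ≤pred[n] _) (toℕ≤pred[n] _) eq))
    where open Path p

  module _ (forest : Forest F) {start : Fin n} (p : Path start) where
    open Path p

    forest⇒fresh : ∀ {z} → Edge F (vtx 0) z → z ≢ vtx 1 → ∀ i → i ≤ len → z ≢ vtx i
    forest⇒fresh e z≢vtx₁ zero          _       refl = edge-irrefl F e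
    forest⇒fresh e z≢vtx₁ (suc zero)    _            = z≢vtx₁
    forest⇒fresh e z≢vtx₁ (suc (suc k)) 2+k≤len refl = forest (cycle-from-path vtx k
      (λ i i<2+k → edges i (<-≤-trans i<2+k 2+k≤len))
      (λ i j i≤2+k j≤2+k → inj i j (≤-trans i≤2+k 2+k≤len) (≤-trans j≤2+k 2+k≤len))
      (edge-sym F e))

    extend : ∀ {z} → Edge F (vtx 0) z → z ≢ vtx 1 → Path start
    extend {z} e z≢vtx₁ = record
      { len = suc len ; vtx = vtx′ ; ends = ends ; edges = edges′ ; inj = inj′ }
      where
      vtx′ : ℕ → Fin n
      vtx′ zero    = z
      vtx′ (suc i) = vtx i
      edges′ : ∀ i → i < suc len → Edge F (vtx′ i) (vtx′ (suc i))
      edges′ zero    _           = edge-sym F e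
      edges′ (suc i) (s≤s i<len) = edges i i<len
      inj′ : ∀ i j → i ≤ suc len → j ≤ suc len → vtx′ i ≡ vtx′ j → i ≡ j
      inj′ zero    zero    _           _           _  = refl
      inj′ zero    (suc j) _           (s≤s j≤len) eq = ⊥-elim (forest⇒fresh e z≢vtx₁ j j≤len eq)
      inj′ (suc i) zero    (s≤s i≤len) _           eq =
        ⊥-elim (forest⇒fresh e z≢vtx₁ i i≤len (sym eq))
      inj′ (suc i) (suc j) (s≤s i≤len) (s≤s j≤len) eq = cong suc (inj i j i≤len j≤len eq)

-- The walk never returns to start, so step need only establish P z for z ≢ start.
module _ {n : ℕ} {F : Graph n} (forest : Forest F) (P : Fin n → Set) {Goal : Set} {start : Fin n}
  (step : ∀ prev y → P y → Goal ⊎ ∃ λ z → Edge F y z × z ≢ prev × (z ≢ start → P z)) where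

  nonbacktracking-walk : ∀ {b} → Edge F start b → P b → Goal
  nonbacktracking-walk {b} e Pb = walk n (extend forest (trivial-path start) e b≢start) Pb (m≤n+m n 1)
    where
    b≢start : b ≢ start
    b≢start refl = edge-irrefl F e
    walk : (fuel : ℕ) (p : Path start) → P (Path.vtx p 0) → n ≤ Path.len p + fuel → Goal
    walk zero p _ n≤len+0 =
      contradiction (≤-trans n≤len+0 (≤-reflexive (+-identityʳ _))) (<⇒≱ (path-len<n p))
    walk (suc fuel) p Py n≤len+1+fuel = [ id , continue ]′ (step (vtx 1) (vtx 0) Py)
      where
      open Path p
      continue : (∃ λ z → Edge F (vtx 0) z × z ≢ vtx 1 × (z ≢ start → P z)) → Goal
      continue (z , e , z≢prev , Pz) =
        walk fuel (extend forest p e z≢prev) (Pz z≢start)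
             (≤-trans n≤len+1+fuel (≤-reflexive (+-suc len fuel)))
        where
        z≢start : z ≢ start
        z≢start z≡start = forest⇒fresh forest p e z≢prev len ≤-refl (trans z≡start (sym ends))

surjection⇒≤ : ∀ {n m} {π : Fin n → Fin m} → (∀ a → ∃ λ u → π u ≡ a) → m ≤ n
surjection⇒≤ {π = π} surj = injective⇒≤ {f = proj₁ ∘ surj}
  (λ {a} {b} eq → trans (sym (proj₂ (surj a))) (trans (cong π eq) (proj₂ (surj b))))

module Contraction {n : ℕ} (G F : Graph n) (sub : F ⊆G G) {m : ℕ} (π : Fin n → Fin m)
                   (cm : IsContractionMap F m π) (cs : ContrSimple G F π) where

  π≡⇒F-reach : ∀ {u v} → π u ≡ π v → Reach (Edge F) ∅ u v
  π≡⇒F-reach = Equivalence.to (proj₁ cm _ _)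

  F-edge⇒π≡ : ∀ {u v} → Edge F u v → π u ≡ π v
  F-edge⇒π≡ e = Equivalence.from (proj₁ cm _ _) (step e ∉⊥ here)

  cross-edge⇒π≢ : ∀ {u v} → Edge G u v → adj F u v ≡ false → π u ≢ π v
  cross-edge⇒π≢ = proj₁ cs _ _

  cross-edges-into-fibre-unique : ∀ {y z z′} → Edge G y z → adj F y z ≡ false →
                                  Edge G y z′ → adj F y z′ ≡ false → π z ≡ π z′ → z ≡ z′
  cross-edges-into-fibre-unique {y} {z} {z′} e nf e′ nf′ πz≡πz′
    with proj₂ cs y z y z′ e nf e′ nf′ refl πz≡πz′
  ... | inj₁ (_ , z≡z′) = z≡z′
  ... | inj₂ (_ , z≡y)  = ⊥-elim (edge-irrefl G (subst (Edge G y) z≡y e))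

  module Escape (minD : minDegree≥ 3 G) (forest : Forest F) (S : Subset n) (s s′ : Fin n)
                (cov : ∀ {x} → x ∈ S → x ≡ s ⊎ x ≡ s′) where

    Good : Fin m → Set
    Good a = a ≢ π s × a ≢ π s′

    good? : ∀ a → Dec (Good a)
    good? a = ¬? (a ≟ π s) ×-dec ¬? (a ≟ π s′)

    ≢s,s′⇒∉S : ∀ {y} → y ≢ s → y ≢ s′ → y ∉ S
    ≢s,s′⇒∉S y≢s y≢s′ y∈S = [ y≢s , y≢s′ ]′ (cov y∈S)

    good⇒∉S : ∀ {y} → Good (π y) → y ∉ S
    good⇒∉S (≢πs , ≢πs′) = ≢s,s′⇒∉S (≢πs ∘ cong π) (≢πs′ ∘ cong π)

    cross-edge-to-bad-fibre⇒π≡πs′ : ∀ {y z} → π y ≡ π s → Edge G y z → adj F y z ≡ false →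
                                     ¬ Good (π z) → π z ≡ π s′
    cross-edge-to-bad-fibre⇒π≡πs′ {y} {z} πy≡πs e nf not-good with π z ≟ π s′
    ... | yes πz≡πs′ = πz≡πs′
    ... | no  πz≢πs′ = ⊥-elim (not-good (πz≢πs , πz≢πs′))
      where
      πz≢πs : π z ≢ π s
      πz≢πs πz≡πs = cross-edge⇒π≢ e nf (trans πy≡πs (sym πz≡πs))

    module _ (x : Fin n) where

      Escapes : Set
      Escapes = ∃ λ y → Good (π y) × Reach (Edge G) S x y

      ReachedInFibre : Fin n → Set
      ReachedInFibre y = y ∉ S × π y ≡ π s × Reach (Edge G) S x y

      extend-in-fibre : ∀ {y z} → ReachedInFibre y → Edge F y z → z ≢ s → z ≢ s′ →
                        ReachedInFibre z
      extend-in-fibre {z = z} (_ , πy≡πs , x⇝y) e z≢s z≢s′ =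
        z∉S , trans (sym (F-edge⇒π≡ e)) πy≡πs , reach-trans x⇝y (step (sub _ _ e) z∉S here)
        where
        z∉S : z ∉ S
        z∉S = ≢s,s′⇒∉S z≢s z≢s′

      -- r is the end of the only non-F edge at y, or s′ if there is none.
      escapes-or-one-cross-edge : ∀ {y} → ReachedInFibre y →
        Escapes ⊎ ∃ λ r → ∀ {z} → Edge G y z → z ≢ r → Edge F y z × z ≢ s′
      escapes-or-one-cross-edge {y} (_ , πy≡πs , x⇝y)
        with any? (λ z → (adj G y z ≟ᵇ true) ×-dec ((adj F y z ≟ᵇ false) ×-dec good? (π z)))
      ... | yes (z , e , nf , good) =
        inj₁ (z , good , reach-trans x⇝y (step e (good⇒∉S good) here))
      ... | no no-exit with any? (λ z → (adj G y z ≟ᵇ true) ×-dec (adj F y z ≟ᵇ false))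
      ...   | no no-cross = inj₂ (s′ , λ e z≢s′ → ¬-not (λ nf → no-cross (_ , e , nf)) , z≢s′)
      ...   | yes (q , eq , nfq) = inj₂ (q , only-q)
        where
        into-πs′ : ∀ {z} → Edge G y z → adj F y z ≡ false → π z ≡ π s′
        into-πs′ e nf = cross-edge-to-bad-fibre⇒π≡πs′ πy≡πs e nf (λ good → no-exit (_ , e , nf , good))
        only-q : ∀ {z} → Edge G y z → z ≢ q → Edge F y z × z ≢ s′
        only-q {z} e z≢q = fe , z≢s′
          where
          fe : Edge F y z
          fe = ¬-not (λ nf → z≢q (cross-edges-into-fibre-unique e nf eq nfq
                                   (trans (into-πs′ e nf) (sym (into-πs′ eq nfq)))))
          z≢s′ : z ≢ s′
          z≢s′ refl = cross-edge⇒π≢ eq nfq (trans (F-edge⇒π≡ fe) (sym (into-πs′ eq nfq)))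

      advance : ∀ prev y → ReachedInFibre y →
                Escapes ⊎ ∃ λ z → Edge F y z × z ≢ prev × (z ≢ s → ReachedInFibre z)
      advance prev y in-y with escapes-or-one-cross-edge in-y
      ... | inj₁ esc = inj₁ esc
      ... | inj₂ (r , only-r) with deg≥3⇒neighbour-avoiding G (minD y) prev r
      ...   | z , e , z≢prev , z≢r with only-r e z≢r
      ...     | fe , z≢s′ = inj₂ (z , fe , z≢prev , λ z≢s → extend-in-fibre in-y fe z≢s z≢s′)

      advance-until-s : ∀ prev y → ReachedInFibre y →
                        (Escapes ⊎ ∃ λ t → ReachedInFibre t × Edge F s t)
                        ⊎ ∃ λ z → Edge F y z × z ≢ prev × (z ≢ x → ReachedInFibre z)
      advance-until-s prev y in-y with advance prev y in-y
      ... | inj₁ esc = inj₁ (inj₁ esc)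
      ... | inj₂ (z , e , z≢prev , in-z) with z ≟ s
      ...   | yes refl = inj₁ (inj₂ (y , in-y , edge-sym F e))
      ...   | no  z≢s  = inj₂ (z , e , z≢prev , λ _ → in-z z≢s)

      escape-from-fibre : x ∉ S → π x ≡ π s → Escapes
      escape-from-fibre x∉S πx≡πs with advance s x (x∉S , πx≡πs , here)
      ... | inj₁ esc = esc
      ... | inj₂ (z , e , z≢s , in-z)
        with nonbacktracking-walk forest ReachedInFibre advance-until-s e (in-z z≢s)
      ...   | inj₁ esc                = esc
      ...   | inj₂ (t , in-t , s–t) = nonbacktracking-walk forest ReachedInFibre advance s–t in-t

  module Separation (minD : minDegree≥ 3 G) (forest : Forest F) (S : Subset n) (s₁ s₂ : Fin n)
                    (cov : ∀ {x} → x ∈ S → x ≡ s₁ ⊎ x ≡ s₂) where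

    open Escape minD forest S s₁ s₂ cov using (Good; Escapes; escape-from-fibre)
    module Escape₂ = Escape minD forest S s₂ s₁ (Sum.swap ∘ cov)

    ∉S⇒escapes : ∀ {x} → x ∉ S → Escapes x
    ∉S⇒escapes {x} x∉S with π x ≟ π s₁ | π x ≟ π s₂
    ... | yes πx≡πs₁ | _          = escape-from-fibre x x∉S πx≡πs₁
    ... | no  _      | yes πx≡πs₂ =
      Product.map₂ (Product.map₁ Product.swap) (Escape₂.escape-from-fibre x x∉S πx≡πs₂)
    ... | no  πx≢πs₁ | no  πx≢πs₂ = x , (πx≢πs₁ , πx≢πs₂) , here

    Sπ : Subset m
    Sπ = ⁅ π s₁ ⁆ ∪ ⁅ π s₂ ⁆

    good⇒∉Sπ : ∀ {a} → Good a → a ∉ Sπ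
    good⇒∉Sπ (a≢πs₁ , a≢πs₂) a∈Sπ =
      [ a≢πs₁ ∘ x∈⁅y⁆⇒x≡y _ , a≢πs₂ ∘ x∈⁅y⁆⇒x≡y _ ]′ (x∈p∪q⁻ _ _ a∈Sπ)

    π∉Sπ⇒∉S : ∀ {y} → π y ∉ Sπ → y ∉ S
    π∉Sπ⇒∉S πy∉Sπ y∈S =
      πy∉Sπ (x∈p∪q⁺ (Sum.map (λ { refl → x∈⁅x⁆ _ }) (λ { refl → x∈⁅x⁆ _ }) (cov y∈S)))

    F-reach⇒G-reach : ∀ {a b} → Reach (Edge F) ∅ a b → π a ∉ Sπ → Reach (Edge G) S a b
    F-reach⇒G-reach here                 _     = here
    F-reach⇒G-reach (step {w = w} e _ R) πa∉Sπ =
      step (sub _ _ e) (π∉Sπ⇒∉S πw∉Sπ) (F-reach⇒G-reach R πw∉Sπ)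
      where
      πw∉Sπ : π w ∉ Sπ
      πw∉Sπ = subst (_∉ Sπ) (F-edge⇒π≡ e) πa∉Sπ

    lift : ∀ {a b y y′} → Reach (ContrEdge G F π) Sπ a b → π y ≡ a → π y′ ≡ b → a ∉ Sπ →
           Reach (Edge G) S y y′
    lift here refl πy′≡a πy∉Sπ = F-reach⇒G-reach (π≡⇒F-reach (sym πy′≡a)) πy∉Sπ
    lift (step (u , v , e , _ , πu≡a , refl) πv∉Sπ R) refl πy′≡b πy∉Sπ =
      reach-trans (F-reach⇒G-reach (π≡⇒F-reach (sym πu≡a)) πy∉Sπ)
                  (step e (π∉Sπ⇒∉S πv∉Sπ) (lift R refl πy′≡b πv∉Sπ))

    connected : KConnected 3 m (ContrEdge G F π) →
                ∀ {u v} → u ∉ S → v ∉ S → Reach (Edge G) S u v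
    connected (_ , contraction-connected) u∉S v∉S =
      let y  , good-y  , u⇝y  = ∉S⇒escapes u∉S
          y′ , good-y′ , v⇝y′ = ∉S⇒escapes v∉S
          πy⇝πy′ = contraction-connected Sπ (s≤s (∣⁅x⁆∪⁅y⁆∣≤2 (π s₁) (π s₂))) _ _
                                         (good⇒∉Sπ good-y) (good⇒∉Sπ good-y′)
      in reach-trans u⇝y (reach-trans (lift πy⇝πy′ refl refl (good⇒∉Sπ good-y))
                                      (reach-reverse (edge-sym G) v∉S v⇝y′))

lemma2p3 : ∀ {n : ℕ} (G F : Graph n) → minDegree≥ 3 G → F ⊆G G → Forest F
           → (m : ℕ) (π : Fin n → Fin m) → IsContractionMap F m π
           → ContrSimple G F π → KConnected 3 m (ContrEdge G F π)
           → ThreeConnected G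
lemma2p3 G F minD sub forest m π cm cs contraction-3-connected@(3<m , _) =
  <-≤-trans 3<m (surjection⇒≤ (proj₂ cm)) , G-S-connected
  where
  G-S-connected : ∀ S → ∣ S ∣ < 3 → ∀ u v → u ∉ S → v ∉ S → Reach (Edge G) S u v
  G-S-connected S ∣S∣<3 u v u∉S v∉S =
    let s₁ , s₂ , cov = covered-by-two S ∣S∣<3 u
    in Contraction.Separation.connected G F sub π cm cs minD forest S s₁ s₂ cov
                                        contraction-3-connected u∉S v∉S
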